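{- Let $d\ge1$, $1\le k\le d$, $e$ a divisor of $\gcd(d,k)$, $d=ed'$, $k=ek'$. For $S\in M_e(d,k)$ let $\psi(S)$ be the image of $S$ under the reduction map $\mathbb{Z}/d\mathbb{Z}\to\mathbb{Z}/d'\mathbb{Z}$. Then $\psi(S)\in M_1(d',k')$, and $\psi:M_e(d,k)\to M_1(d',k')$ is a bijection satisfying $\psi(\nu\cdot S)=(\nu\bmod d')\cdot\psi(S)$ for all $\nu$, i.e. an isomorphism of $\mathbb{Z}/d'\mathbb{Z}$-sets (where $\mathbb{Z}/d'\mathbb{Z}\cong(\mathbb{Z}/d\mathbb{Z})/(d'\mathbb{Z}/d\mathbb{Z})$ acts on $M_e(d,k)$). In particular $\#M_e(d,k)=\#M_1(d/e,k/e)$.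
   Context: For $n\ge1$ and $1\le r\le n$, $M(n,r)$ is the set of $r$-element subsets of $\mathbb{Z}/n\mathbb{Z}$ with $\mathbb{Z}/n\mathbb{Z}$ acting by translation $\nu\cdot S=\{s+\nu:s\in S\}$; for $f\mid\gcd(n,r)$, $M_f(n,r)$ is the set of $S\in M(n,r)$ whose stabilizer has order $f$. The subgroup $d'\mathbb{Z}/d\mathbb{Z}$ (of order $e$) stabilizes every element of $M_e(d,k)$. -}

module Defs where

open import Data.Nat using (ℕ; zero; suc; _*_; NonZero; _≡ᵇ_)
open import Data.Nat.DivMod using (_%_; m%n<n)
open import Data.Bool using (Bool; true; false)
import Data.Bool.Properties as BoolP
open import Data.Fin using (Fin; toℕ; fromℕ<) renaming (_≟_ to _≟F_)
open import Data.Fin.Properties using (any?)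
open import Data.Fin.Subset using (Subset; _∈_; ∣_∣)
open import Data.Fin.Subset.Properties using (_∈?_)
open import Data.Vec using (Vec; []; _∷_; tabulate)
open import Data.Vec.Properties using (≡-dec)
open import Data.List using (List; []; _∷_; map; _++_; filter; length)
open import Data.Product using (_×_; _,_)
open import Relation.Nullary using (does)
open import Relation.Nullary.Decidable using (_×-dec_)
open import Relation.Binary.PropositionalEquality using (_≡_)
import Data.Nat.Properties as NatP

-- Z/nZ is modelled by Fin n (n ≥ 1), with residues 0..n-1.

_+ₙ_ : ∀ {n} .{{_ : NonZero n}} → Fin n → Fin n → Fin n
_+ₙ_ {n} x y = fromℕ< (m%n<n (toℕ x Data.Nat.+ toℕ y) n)

reduce : ∀ {d} (d' : ℕ) .{{_ : NonZero d'}} → Fin d → Fin d'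
reduce d' i = fromℕ< (m%n<n (toℕ i) d')

image : ∀ {m n} → (Fin m → Fin n) → Subset m → Subset n
image {m} f S = tabulate λ y → does (any? λ x → (x ∈? S) ×-dec (f x ≟F y))

_·_ : ∀ {n} .{{_ : NonZero n}} → Fin n → Subset n → Subset n
ν · S = image (λ s → s +ₙ ν) S

stab : ∀ {n} .{{_ : NonZero n}} → Subset n → Subset n
stab S = tabulate λ ν → does (≡-dec BoolP._≟_ (ν · S) S)

-- S ∈ M_f(n,r): S is an r-element subset whose stabilizer has order f
InM : (f n r : ℕ) .{{_ : NonZero n}} → Subset n → Set
InM f n r S = (∣ S ∣ ≡ r) × (∣ stab S ∣ ≡ f)

allSubsets : ∀ n → List (Subset n)
allSubsets zero = [] ∷ []
allSubsets (suc n) = map (true ∷_) (allSubsets n) ++ map (false ∷_) (allSubsets n)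

cardM : (f n r : ℕ) .{{_ : NonZero n}} → ℕ
cardM f n r = length (filter (λ S → (∣ S ∣ NatP.≟ r) ×-dec (∣ stab S ∣ NatP.≟ f)) (allSubsets n))

nonZero-factor : ∀ {d e d'} → d ≡ e * d' → NonZero d → NonZero d'
nonZero-factor {e = e} {d' = zero} eq nz with Relation.Binary.PropositionalEquality.trans eq (NatP.*-zeroʳ e)
... | Relation.Binary.PropositionalEquality.refl = nz
nonZero-factor {d' = suc _} _ _ = _

module Submission where

-- A subset S ⊆ ℤ/nℤ is identified with its characteristic function χ S : ℕ → Bool, which
-- is n-periodic, and ν stabilizes S exactly when toℕ ν is a period of χ S.  The periods of an
-- n-periodic function are the multiples of its least positive period m, so the stabilizer has
-- n / m elements.  Hence S ∈ M_e(d, k) forces m = d', i.e. χ S is d'-periodic with no smaller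
-- period; such S are exactly the preimages of subsets of ℤ/d'ℤ with trivial stabilizer, and a
-- d'-periodic subset has e times as many elements as its reduction.

open import Defs

open import Algebra.Properties.CommutativeSemigroup using (xy∙z≈xz∙y)
open import Data.Bool using (Bool; true; false; if_then_else_)
import Data.Bool.Properties as Bool
open import Data.Fin using (Fin; toℕ; fromℕ<; inject)
import Data.Fin.Properties as Fin
open import Data.Fin.Subset using (Subset; ∣_∣)
open import Data.List using (List; map; filter; length)
open import Data.List.Properties using (length-map)
open import Data.List.Membership.Propositional using (_∈_)
open import Data.List.Membership.Propositional.Properties
  using (∈-map⁺; ∈-map⁻; ∈-++⁺ˡ; ∈-++⁺ʳ; ∈-filter⁺; ∈-filter⁻)
open import Data.List.Membership.Propositional.Properties.WithK using (unique∧set⇒bag)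
open import Data.List.Relation.Binary.BagAndSetEquality using (∼bag⇒↭; _∼[_]_; bag)
open import Data.List.Relation.Binary.Permutation.Propositional.Properties using (↭-length)
import Data.List.Relation.Unary.All as All
import Data.List.Relation.Unary.AllPairs as AllPairs
open import Data.List.Relation.Unary.Any using (here)
open import Data.List.Relation.Unary.Unique.Propositional using (Unique)
import Data.List.Relation.Unary.Unique.Propositional.Properties as Unique
open import Data.Nat
  using (ℕ; zero; suc; _+_; _*_; _∸_; _<_; _≤_; NonZero; ≢-nonZero; ≢-nonZero⁻¹; s≤s⁻¹; z<s; s<s)
open import Data.Nat.DivMod
  using (_%_; _/_; m≡m%n+[m/n]*n; m%n<n; [m+n]%n≡m%n; m∣n⇒o%n%m≡o%m; m<n⇒m%n≡m)
open import Data.Nat.Divisibility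
  using (_∣_; _∣?_; divides; m%n≡0⇒n∣m; ∣-refl; _∣0; ∣⇒≤; ∣m+n∣m⇒∣n; ∣m∣n⇒∣m+n)
open import Data.Nat.GCD using (gcd)
open import Data.Nat.Properties
  using ( +-assoc; +-comm; +-identityʳ; +-commutativeSemigroup; *-suc; *-zeroʳ; *-identityˡ
        ; *-identityʳ; *-cancelˡ-≡; ≤-refl; <⇒≤; <⇒≱; m+[n∸m]≡n; suc-pred; m≤pred[n]⇒suc[m]≤n )
open import Data.Product using (Σ; _×_; _,_; proj₁; proj₂)
open import Data.Vec using ([]; _∷_; tabulate; lookup)
open import Data.Vec.Properties
  using (≡-dec; ∷-injectiveʳ; lookup∘tabulate; tabulate∘lookup; tabulate-cong; []=⇒lookup; lookup⇒[]=)
open import Function using (_∘_)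
open import Function.Bundles using (_⇔_; mk⇔; Equivalence)
import Function.Properties.Equivalence as ⇔
open import Level using (0ℓ)
open import Relation.Binary.Definitions using (DecidableEquality)
open import Relation.Binary.PropositionalEquality
open import Relation.Nullary using (Dec; yes; no; does; ¬_; ¬?)
open import Relation.Nullary.Decidable using (map′; decidable-stable; dec-true; dec-false)
open import Relation.Nullary.Negation using (contradiction)
open import Relation.Unary using (Pred; Decidable)

+-rightComm : ∀ x y z → x + y + z ≡ x + z + y
+-rightComm = xy∙z≈xz∙y +-commutativeSemigroup

bool-ext : ∀ {b c : Bool} → b ≡ true ⇔ c ≡ true → b ≡ c
bool-ext {false} {false} _   = refl
bool-ext {false} {true}  b⇔c = Equivalence.from b⇔c refl
bool-ext {true}  {false} b⇔c = sym (Equivalence.to b⇔c refl)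
bool-ext {true}  {true}  _   = refl

does⇔ : ∀ {A : Set} (a? : Dec A) → does a? ≡ true ⇔ A
does⇔ (yes a) = mk⇔ (λ _ → a) (λ _ → refl)
does⇔ (no ¬a) = mk⇔ (λ ()) (λ a → contradiction a ¬a)

-- Periodic functions on ℕ with values in an arbitrary type.
module _ {A : Set} where

  Periodic : ℕ → (ℕ → A) → Set
  Periodic p f = ∀ i → f (i + p) ≡ f i

  periodic-≗ : ∀ {p} {f g : ℕ → A} → (∀ i → f i ≡ g i) → Periodic p f ⇔ Periodic p g
  periodic-≗ f≗g = mk⇔ (λ pf i → trans (sym (f≗g _)) (trans (pf i) (f≗g i)))
                       (λ pg i → trans (f≗g _) (trans (pg i) (sym (f≗g i))))

  periodic-multiple : ∀ {p} {f : ℕ → A} → Periodic p f → ∀ q i → f (i + q * p) ≡ f i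
  periodic-multiple {p} {f} pf zero i = cong f (+-identityʳ i)
  periodic-multiple {p} {f} pf (suc q) i = begin
    f (i + (p + q * p)) ≡⟨ cong f (sym (+-assoc i p (q * p))) ⟩
    f (i + p + q * p)   ≡⟨ periodic-multiple pf q (i + p) ⟩
    f (i + p)           ≡⟨ pf i ⟩
    f i                 ∎
    where open ≡-Reasoning

  periodic-∣ : ∀ {m ν} {f : ℕ → A} → Periodic m f → m ∣ ν → Periodic ν f
  periodic-∣ pm (divides q refl) = periodic-multiple pm q

  periodic-mod : ∀ {p} .{{_ : NonZero p}} {f : ℕ → A} → Periodic p f → ∀ i → f (i % p) ≡ f i
  periodic-mod {p} {f} pf i = begin
    f (i % p)                 ≡⟨ periodic-multiple pf (i / p) (i % p) ⟨
    f (i % p + (i / p) * p)   ≡⟨ cong f (m≡m%n+[m/n]*n i p) ⟨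
    f i                       ∎
    where open ≡-Reasoning

  periodic-difference : ∀ {r s} {f : ℕ → A} → Periodic (r + s) f → Periodic s f → Periodic r f
  periodic-difference {r} {s} {f} prs ps i = begin
    f (i + r)       ≡⟨ ps (i + r) ⟨
    f (i + r + s)   ≡⟨ cong f (+-assoc i r s) ⟩
    f (i + (r + s)) ≡⟨ prs i ⟩
    f i             ∎
    where open ≡-Reasoning

  periodic-remainder : ∀ {a p} .{{_ : NonZero p}} {f : ℕ → A} → Periodic a f → Periodic p f → Periodic (a % p) f
  periodic-remainder {a} {p} {f} pa pp = periodic-difference
    (subst (λ x → Periodic x f) (m≡m%n+[m/n]*n a p) pa) (periodic-∣ pp (divides (a / p) refl))

  -- Two n-periodic functions (n > 0) that agree at every point shifted by c agree everywhere:
  -- every x is congruent mod n to some j + c.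
  periodic-agree : ∀ {n} .{{_ : NonZero n}} {g h : ℕ → A} → Periodic n g → Periodic n h →
    ∀ c → (∀ j → g (j + c) ≡ h (j + c)) → ∀ x → g x ≡ h x
  periodic-agree {suc n-1} {g} {h} pg ph c agree x = begin
    g x                   ≡⟨ periodic-multiple pg c x ⟨
    g (x + c * suc n-1)   ≡⟨ cong g x+cn ⟩
    g (x + c * n-1 + c)   ≡⟨ agree (x + c * n-1) ⟩
    h (x + c * n-1 + c)   ≡⟨ cong h x+cn ⟨
    h (x + c * suc n-1)   ≡⟨ periodic-multiple ph c x ⟩
    h x                   ∎
    where
    open ≡-Reasoning
    x+cn : x + c * suc n-1 ≡ x + c * n-1 + c
    x+cn = trans (cong (x +_) (trans (*-suc c n-1) (+-comm c (c * n-1)))) (sym (+-assoc x (c * n-1) c))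

  periodic-unshift : ∀ {n p} .{{_ : NonZero n}} {g f : ℕ → A} → Periodic n g → Periodic p f →
    ∀ c → (∀ j → g (j + c) ≡ f j) → Periodic p g
  periodic-unshift {n} {p} {g} {f} pg pf c shift = periodic-agree {g = λ x → g (x + p)} pgp pg c λ j → begin
    g (j + c + p) ≡⟨ cong g (+-rightComm j c p) ⟩
    g (j + p + c) ≡⟨ shift (j + p) ⟩
    f (j + p)     ≡⟨ pf j ⟩
    f j           ≡⟨ shift j ⟨
    g (j + c)     ∎
    where
    open ≡-Reasoning
    pgp : Periodic n (λ x → g (x + p))
    pgp i = trans (cong g (+-rightComm i n p)) (pg (i + p))

module _ {A : Set} (_≟_ : DecidableEquality A) {n : ℕ} .{{_ : NonZero n}} {f : ℕ → A} (pn : Periodic n f) where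

  -- Periodicity of an n-periodic function is decided by the n values f 0, …, f (n-1).
  periodic? : ∀ ν → Dec (Periodic ν f)
  periodic? ν = map′ fromResidues (λ pν x → pν (toℕ x)) (Fin.all? λ x → f (toℕ x + ν) ≟ f (toℕ x))
    where
    fromResidues : (∀ (x : Fin n) → f (toℕ x + ν) ≡ f (toℕ x)) → Periodic ν f
    fromResidues onResidues i = begin
      f (i + ν)                   ≡⟨ cong (λ j → f (j + ν)) (m≡m%n+[m/n]*n i n) ⟩
      f (i % n + (i / n) * n + ν) ≡⟨ cong f (+-rightComm (i % n) _ ν) ⟩
      f (i % n + ν + (i / n) * n) ≡⟨ periodic-multiple pn (i / n) (i % n + ν) ⟩
      f (i % n + ν)               ≡⟨ onResidue ⟩
      f (i % n)                   ≡⟨ periodic-mod pn i ⟩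
      f i                         ∎
      where
      open ≡-Reasoning
      onResidue : f (i % n + ν) ≡ f (i % n)
      onResidue = subst (λ j → f (j + ν) ≡ f j) (Fin.toℕ-fromℕ< _) (onResidues (fromℕ< (m%n<n i n)))

  -- n is a positive period, so some suc (toℕ x) with x : Fin n is one.
  some-period : ¬ (∀ (x : Fin n) → ¬ Periodic (suc (toℕ x)) f)
  some-period noPeriod = noPeriod last (subst (λ p → Periodic p f) (sym suc-last≡n) pn)
    where
    last : Fin n
    last = fromℕ< (m≤pred[n]⇒suc[m]≤n ≤-refl)
    suc-last≡n : suc (toℕ last) ≡ n
    suc-last≡n = trans (cong suc (Fin.toℕ-fromℕ< _)) (suc-pred n)

  least-period : Σ ℕ λ m → Periodic (suc m) f × (∀ r → r < m → ¬ Periodic (suc r) f)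
  least-period with Fin.¬∀⟶∃¬-smallest n (λ x → ¬ Periodic (suc (toℕ x)) f) (λ x → ¬? (periodic? _)) some-period
  ... | i , ¬¬period , smallerNotPeriods = toℕ i , decidable-stable (periodic? _) ¬¬period , smaller
    where
    smaller : ∀ r → r < toℕ i → ¬ Periodic (suc r) f
    smaller r r<i = subst (λ x → ¬ Periodic (suc x) f) toℕ-r (smallerNotPeriods (fromℕ< r<i))
      where
      toℕ-r : toℕ (inject {i = i} (fromℕ< r<i)) ≡ r
      toℕ-r = trans (Fin.toℕ-inject (fromℕ< r<i)) (Fin.toℕ-fromℕ< r<i)

  -- The periods of f are exactly the multiples of its least positive period,
  -- because the remainder of a period modulo the least one is again a period.
  periods-are-multiples : Σ ℕ λ m → ∀ ν → Periodic ν f ⇔ m ∣ ν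
  periods-are-multiples with least-period
  ... | m-1 , pm , noSmaller = suc m-1 , λ ν → mk⇔ (multiple ν) (periodic-∣ pm)
    where
    multiple : ∀ ν → Periodic ν f → suc m-1 ∣ ν
    multiple ν pν with ν % suc m-1 in eq
    ... | zero  = m%n≡0⇒n∣m ν (suc m-1) eq
    ... | suc r = contradiction (subst (λ x → Periodic x f) eq (periodic-remainder pν pm))
                                (noSmaller r (s≤s⁻¹ (subst (_< suc m-1) eq (m%n<n ν (suc m-1)))))

countBelow : ℕ → (ℕ → Bool) → ℕ
countBelow zero    b = 0
countBelow (suc n) b = if b 0 then suc (countBelow n (b ∘ suc)) else countBelow n (b ∘ suc)

countBelow-cong : ∀ n {b c : ℕ → Bool} → (∀ i → i < n → b i ≡ c i) → countBelow n b ≡ countBelow n c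
countBelow-cong zero    b≗c = refl
countBelow-cong (suc n) b≗c
  rewrite b≗c 0 z<s | countBelow-cong n (λ i i<n → b≗c (suc i) (s<s i<n)) = refl

countBelow-false : ∀ n → countBelow n (λ _ → false) ≡ 0
countBelow-false zero    = refl
countBelow-false (suc n) = countBelow-false n

countBelow-+ : ∀ a m (b : ℕ → Bool) → countBelow (a + m) b ≡ countBelow a b + countBelow m (λ i → b (a + i))
countBelow-+ zero    m b = refl
countBelow-+ (suc a) m b with b 0
... | true  = cong suc (countBelow-+ a m (b ∘ suc))
... | false = countBelow-+ a m (b ∘ suc)

countBelow-periodic : ∀ {p} {b : ℕ → Bool} → Periodic p b → ∀ q → countBelow (q * p) b ≡ q * countBelow p b
countBelow-periodic         pb zero    = refl
countBelow-periodic {p} {b} pb (suc q) = begin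
  countBelow (p + q * p) b                              ≡⟨ countBelow-+ p (q * p) b ⟩
  countBelow p b + countBelow (q * p) (λ i → b (p + i)) ≡⟨ cong (countBelow p b +_) (countBelow-cong (q * p) shifted) ⟩
  countBelow p b + countBelow (q * p) b                 ≡⟨ cong (countBelow p b +_) (countBelow-periodic pb q) ⟩
  countBelow p b + q * countBelow p b                   ∎
  where
  open ≡-Reasoning
  shifted : ∀ i → i < q * p → b (p + i) ≡ b i
  shifted i _ = trans (cong b (+-comm p i)) (pb i)

multipleOf : ℕ → ℕ → Bool
multipleOf m ν = does (m ∣? ν)

multipleOf-periodic : ∀ m → Periodic m (multipleOf m)
multipleOf-periodic m i =
  bool-ext (⇔.trans (does⇔ (m ∣? (i + m))) (⇔.trans m∣i+m⇔m∣i (⇔.sym (does⇔ (m ∣? i)))))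
  where
  m∣i+m⇔m∣i : (m ∣ i + m) ⇔ (m ∣ i)
  m∣i+m⇔m∣i = mk⇔ (λ m∣i+m → ∣m+n∣m⇒∣n (subst (m ∣_) (+-comm i m) m∣i+m) ∣-refl)
                  (λ m∣i → ∣m∣n⇒∣m+n m∣i ∣-refl)

countBelow-multipleOf : ∀ m .{{_ : NonZero m}} → countBelow m (multipleOf m) ≡ 1
countBelow-multipleOf m@(suc m-1) rewrite dec-true (m ∣? 0) (m ∣0) =
  cong suc (trans (countBelow-cong m-1 onlyZero) (countBelow-false m-1))
  where
  onlyZero : ∀ j → j < m-1 → multipleOf m (suc j) ≡ false
  onlyZero j j<m-1 = dec-false (m ∣? suc j) (λ m∣1+j → <⇒≱ (s<s j<m-1) (∣⇒≤ m∣1+j))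

∣tabulate∣ : ∀ n (g : Fin n → Bool) (h : ℕ → Bool) → (∀ x → g x ≡ h (toℕ x)) →
  ∣ tabulate g ∣ ≡ countBelow n h
∣tabulate∣ zero    g h g≗h = refl
∣tabulate∣ (suc n) g h g≗h with g Fin.zero | h 0 | g≗h Fin.zero | ∣tabulate∣ n (g ∘ Fin.suc) (h ∘ suc) (g≗h ∘ Fin.suc)
... | true  | true  | refl | rest = cong suc rest
... | false | false | refl | rest = rest

image⇔ : ∀ {m k} (f : Fin m → Fin k) (S : Subset m) y →
  lookup (image f S) y ≡ true ⇔ Σ (Fin m) λ x → lookup S x ≡ true × f x ≡ y
image⇔ f S y = ⇔.trans (≡-cong-⇔ (lookup∘tabulate _ y)) (⇔.trans (does⇔ (Fin.any? _)) (mk⇔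
  (λ { (x , x∈S , fx≡y) → x , []=⇒lookup x∈S , fx≡y })
  (λ { (x , Sx , fx≡y) → x , lookup⇒[]= x S Sx , fx≡y })))
  where
  ≡-cong-⇔ : ∀ {b c : Bool} → b ≡ c → b ≡ true ⇔ c ≡ true
  ≡-cong-⇔ refl = ⇔.refl

-- Subsets of ℤ/nℤ as n-periodic Boolean functions on ℕ.
module _ {n : ℕ} .{{_ : NonZero n}} where

  -- The class of i in ℤ/nℤ; note that x +ₙ y = residue (toℕ x + toℕ y) and reduce n x = residue (toℕ x).
  residue : ℕ → Fin n
  residue i = fromℕ< (m%n<n i n)

  residue-cong : ∀ {i j} → i % n ≡ j % n → residue i ≡ residue j
  residue-cong eq = Fin.toℕ-injective (trans (Fin.toℕ-fromℕ< _) (trans eq (sym (Fin.toℕ-fromℕ< _))))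

  periodic-residue : ∀ {A : Set} {g : ℕ → A} → Periodic n g → ∀ {i j} → residue i ≡ residue j → g i ≡ g j
  periodic-residue {g = g} pg {i} {j} i≡j = begin
    g i       ≡⟨ periodic-mod pg i ⟨
    g (i % n) ≡⟨ cong g i%n≡j%n ⟩
    g (j % n) ≡⟨ periodic-mod pg j ⟩
    g j       ∎
    where
    open ≡-Reasoning
    i%n≡j%n : i % n ≡ j % n
    i%n≡j%n = trans (sym (Fin.toℕ-fromℕ< _)) (trans (cong toℕ i≡j) (Fin.toℕ-fromℕ< _))

  residue-periodic : Periodic n residue
  residue-periodic i = residue-cong ([m+n]%n≡m%n i n)

  residue-toℕ : ∀ x → residue (toℕ x) ≡ x
  residue-toℕ x = Fin.toℕ-injective (trans (Fin.toℕ-fromℕ< _) (m<n⇒m%n≡m (Fin.toℕ<n x)))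

  residue-+ : ∀ x k → residue (toℕ (residue x) + k) ≡ residue (x + k)
  residue-+ x k = trans (cong (λ y → residue (y + k)) (Fin.toℕ-fromℕ< _)) (periodic-mod shifted x)
    where
    shifted : Periodic n (λ y → residue (y + k))
    shifted y = trans (cong residue (+-rightComm y n k)) (residue-periodic (y + k))

  residue-cancel : ∀ {a b c} → c ≤ n → residue (a + c) ≡ residue (b + c) → residue a ≡ residue b
  residue-cancel {a} {b} {c} c≤n eq = begin
    residue a                                  ≡⟨ residue-periodic a ⟨
    residue (a + n)                            ≡⟨ cong residue (complete a) ⟨
    residue (a + c + (n ∸ c))                  ≡⟨ residue-+ (a + c) (n ∸ c) ⟨
    residue (toℕ (residue (a + c)) + (n ∸ c))  ≡⟨ cong (λ x → residue (toℕ x + (n ∸ c))) eq ⟩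
    residue (toℕ (residue (b + c)) + (n ∸ c))  ≡⟨ residue-+ (b + c) (n ∸ c) ⟩
    residue (b + c + (n ∸ c))                  ≡⟨ cong residue (complete b) ⟩
    residue (b + n)                            ≡⟨ residue-periodic b ⟩
    residue b                                  ∎
    where
    open ≡-Reasoning
    complete : ∀ x → x + c + (n ∸ c) ≡ x + n
    complete x = trans (+-assoc x c (n ∸ c)) (cong (x +_) (m+[n∸m]≡n c≤n))

  χ : Subset n → ℕ → Bool
  χ S i = lookup S (residue i)

  χ-toℕ : ∀ S x → χ S (toℕ x) ≡ lookup S x
  χ-toℕ S x = cong (lookup S) (residue-toℕ x)

  χ-periodic : ∀ S → Periodic n (χ S)
  χ-periodic S i = cong (lookup S) (residue-periodic i)

  χ-injective : ∀ {S T} → (∀ i → χ S i ≡ χ T i) → S ≡ T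
  χ-injective {S} {T} χS≗χT = begin
    S                   ≡⟨ tabulate∘lookup S ⟨
    tabulate (lookup S) ≡⟨ tabulate-cong (λ x → trans (sym (χ-toℕ S x)) (trans (χS≗χT (toℕ x)) (χ-toℕ T x))) ⟩
    tabulate (lookup T) ≡⟨ tabulate∘lookup T ⟩
    T                   ∎
    where open ≡-Reasoning

  ∣χ∣ : ∀ S → ∣ S ∣ ≡ countBelow n (χ S)
  ∣χ∣ S = trans (cong ∣_∣ (sym (tabulate∘lookup S))) (∣tabulate∣ n (lookup S) (χ S) (sym ∘ χ-toℕ S))

  χ-translate : ∀ ν S i → χ (ν · S) (i + toℕ ν) ≡ χ S i
  χ-translate ν S i = bool-ext (⇔.trans (image⇔ (_+ₙ ν) S (residue (i + toℕ ν))) (mk⇔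
    (λ { (s , Ss , s+ν≡i+ν) → subst (λ x → lookup S x ≡ true) (cancel s s+ν≡i+ν) Ss })
    (λ Si → residue i , Si , residue-+ i (toℕ ν))))
    where
    cancel : ∀ s → s +ₙ ν ≡ residue (i + toℕ ν) → s ≡ residue i
    cancel s eq = trans (sym (residue-toℕ s)) (residue-cancel (<⇒≤ (Fin.toℕ<n ν)) eq)

  stabilizes⇔periodic : ∀ S ν → ν · S ≡ S ⇔ Periodic (toℕ ν) (χ S)
  stabilizes⇔periodic S ν = mk⇔
    (λ ν·S≡S i → trans (cong (λ T → χ T (i + toℕ ν)) (sym ν·S≡S)) (χ-translate ν S i))
    (λ pν → χ-injective (periodic-agree (χ-periodic (ν · S)) (χ-periodic S) (toℕ ν)
      (λ j → trans (χ-translate ν S j) (sym (pν j)))))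

  stabilizer-order : ∀ S m q → (∀ ν → Periodic ν (χ S) ⇔ m ∣ ν) → n ≡ q * m → ∣ stab S ∣ ≡ q
  stabilizer-order S zero q _ n≡q*0 = contradiction (trans n≡q*0 (*-zeroʳ q)) (≢-nonZero⁻¹ n)
  stabilizer-order S m@(suc _) q periods n≡q*m = begin
    ∣ stab S ∣                          ≡⟨ ∣tabulate∣ n _ (multipleOf m) inStab⇔multiple ⟩
    countBelow n (multipleOf m)         ≡⟨ cong (λ x → countBelow x (multipleOf m)) n≡q*m ⟩
    countBelow (q * m) (multipleOf m)   ≡⟨ countBelow-periodic (multipleOf-periodic m) q ⟩
    q * countBelow m (multipleOf m)     ≡⟨ cong (q *_) (countBelow-multipleOf m) ⟩
    q * 1                               ≡⟨ *-identityʳ q ⟩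
    q                                   ∎
    where
    open ≡-Reasoning
    inStab⇔multiple : ∀ ν → does (≡-dec Bool._≟_ (ν · S) S) ≡ multipleOf m (toℕ ν)
    inStab⇔multiple ν = bool-ext (⇔.trans (does⇔ (≡-dec Bool._≟_ (ν · S) S)) (⇔.trans (stabilizes⇔periodic S ν)
      (⇔.trans (periods (toℕ ν)) (⇔.sym (does⇔ (m ∣? toℕ ν))))))

  M-periods : ∀ {f n' r S} → InM f n r S → n ≡ f * n' → ∀ ν → Periodic ν (χ S) ⇔ n' ∣ ν
  M-periods {zero} _ n≡0*n' _ = contradiction n≡0*n' (≢-nonZero⁻¹ n)
  M-periods {f@(suc _)} {n'} {S = S} (_ , ∣stab∣≡f) n≡f*n' with periods-are-multiples Bool._≟_ (χ-periodic S)
  ... | m , periods with Equivalence.to (periods n) (χ-periodic S)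
  ...   | divides q n≡q*m = subst (λ x → ∀ ν → Periodic ν (χ S) ⇔ x ∣ ν) m≡n' periods
    where
    q≡f : q ≡ f
    q≡f = trans (sym (stabilizer-order S m q periods n≡q*m)) ∣stab∣≡f
    m≡n' : m ≡ n'
    m≡n' = *-cancelˡ-≡ m n' f (trans (cong (_* m) (sym q≡f)) (trans (sym n≡q*m) n≡f*n'))

module _ {d d' : ℕ} .{{_ : NonZero d}} .{{_ : NonZero d'}} (d'∣d : d' ∣ d) where

  reduce-residue : ∀ i → reduce d' (residue {d} i) ≡ residue i
  reduce-residue i = residue-cong (trans (cong (_% d') (Fin.toℕ-fromℕ< _)) (m∣n⇒o%n%m≡o%m d' d i d'∣d))

  χ-reduce : ∀ (S : Subset d) → Periodic d' (χ S) → ∀ i → χ (image (reduce d') S) i ≡ χ S i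
  χ-reduce S pS i = bool-ext (⇔.trans (image⇔ (reduce {d} d') S (residue {d'} i)) (mk⇔
    (λ { (x , Sx , x≡i) → trans (periodic-residue pS (sym x≡i)) (trans (χ-toℕ S x) Sx) })
    (λ Si → residue {d} i , Si , reduce-residue i)))

  preimage : Subset d' → Subset d
  preimage U = tabulate (lookup U ∘ reduce d')

  χ-preimage : ∀ U i → χ (preimage U) i ≡ χ U i
  χ-preimage U i = trans (lookup∘tabulate _ (residue i)) (cong (lookup U) (reduce-residue i))

allSubsets-complete : ∀ n (S : Subset n) → S ∈ allSubsets n
allSubsets-complete zero    []          = here refl
allSubsets-complete (suc n) (true ∷ S)  = ∈-++⁺ˡ (∈-map⁺ (true ∷_) (allSubsets-complete n S))
allSubsets-complete (suc n) (false ∷ S) =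
  ∈-++⁺ʳ (map (true ∷_) (allSubsets n)) (∈-map⁺ (false ∷_) (allSubsets-complete n S))

allSubsets-unique : ∀ n → Unique (allSubsets n)
allSubsets-unique zero    = All.[] AllPairs.∷ AllPairs.[]
allSubsets-unique (suc n) = Unique.++⁺ (Unique.map⁺ ∷-injectiveʳ (allSubsets-unique n))
  (Unique.map⁺ ∷-injectiveʳ (allSubsets-unique n)) disjoint
  where
  disjoint : ∀ {S} → ¬ (S ∈ map (true ∷_) (allSubsets n) × S ∈ map (false ∷_) (allSubsets n))
  disjoint (inTrue , inFalse) with ∈-map⁻ (true ∷_) inTrue | ∈-map⁻ (false ∷_) inFalse
  ... | _ , _ , refl | _ , _ , ()

length-filter-bijection : ∀ {A B : Set} (xs : List A) (ys : List B) {P : Pred A 0ℓ} {Q : Pred B 0ℓ}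
  (P? : Decidable P) (Q? : Decidable Q) (φ : B → A) →
  Unique xs → Unique ys → (∀ x → x ∈ xs) → (∀ y → y ∈ ys) →
  (∀ {u v} → φ u ≡ φ v → u ≡ v) →
  (∀ y → Q y → P (φ y)) → (∀ x → P x → Σ B λ y → Q y × φ y ≡ x) →
  length (filter P? xs) ≡ length (filter Q? ys)
length-filter-bijection xs ys P? Q? φ xs-unique ys-unique xs-complete ys-complete φ-injective preserves reflects =
  trans (sym (↭-length (∼bag⇒↭ sameElements))) (length-map φ (filter Q? ys))
  where
  sameElements : map φ (filter Q? ys) ∼[ bag ] filter P? xs
  sameElements = unique∧set⇒bag (Unique.map⁺ φ-injective (Unique.filter⁺ Q? ys-unique))
    (Unique.filter⁺ P? xs-unique) (mk⇔ image⊆ image⊇)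
    where
    image⊆ : ∀ {x} → x ∈ map φ (filter Q? ys) → x ∈ filter P? xs
    image⊆ x∈ with ∈-map⁻ φ x∈
    ... | y , y∈ , refl = ∈-filter⁺ P? (xs-complete _) (preserves y (proj₂ (∈-filter⁻ Q? {xs = ys} y∈)))
    image⊇ : ∀ {x} → x ∈ filter P? xs → x ∈ map φ (filter Q? ys)
    image⊇ {x} x∈ with reflects x (proj₂ (∈-filter⁻ P? {xs = xs} x∈))
    ... | y , Qy , refl = ∈-map⁺ φ (∈-filter⁺ Q? (ys-complete y) Qy)

module Reduction (d e d' k k' : ℕ) .{{_ : NonZero d}} .{{_ : NonZero d'}}
                 (d≡e*d' : d ≡ e * d') (k≡e*k' : k ≡ e * k') where

  -- e ≠ 0 because d ≠ 0; needed to cancel the factor e in sizes.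
  instance
    e≢0 : NonZero e
    e≢0 = ≢-nonZero (λ e≡0 → ≢-nonZero⁻¹ d (trans d≡e*d' (cong (_* d') e≡0)))

  d'∣d : d' ∣ d
  d'∣d = divides e d≡e*d'

  d'≡1*d' : d' ≡ 1 * d'
  d'≡1*d' = sym (*-identityˡ d')

  ψ : Subset d → Subset d'
  ψ = image (reduce d')

  M-d'-periodic : ∀ {S} → InM e d k S → Periodic d' (χ S)
  M-d'-periodic S∈M = Equivalence.from (M-periods S∈M d≡e*d' d') ∣-refl

  χ-ψ : ∀ {S} → InM e d k S → ∀ i → χ (ψ S) i ≡ χ S i
  χ-ψ S∈M = χ-reduce d'∣d _ (M-d'-periodic S∈M)

  ∣d'-periodic∣ : ∀ (S : Subset d) → Periodic d' (χ S) → ∣ S ∣ ≡ e * ∣ ψ S ∣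
  ∣d'-periodic∣ S pS = begin
    ∣ S ∣                       ≡⟨ ∣χ∣ S ⟩
    countBelow d (χ S)          ≡⟨ cong (λ x → countBelow x (χ S)) d≡e*d' ⟩
    countBelow (e * d') (χ S)   ≡⟨ countBelow-periodic pS e ⟩
    e * countBelow d' (χ S)     ≡⟨ cong (e *_) (countBelow-cong d' (λ i _ → χ-reduce d'∣d S pS i)) ⟨
    e * countBelow d' (χ (ψ S)) ≡⟨ cong (e *_) (∣χ∣ (ψ S)) ⟨
    e * ∣ ψ S ∣                 ∎
    where open ≡-Reasoning

  ψ-into : ∀ S → InM e d k S → InM 1 d' k' (ψ S)
  ψ-into S S∈M@(∣S∣≡k , _) = size , stabilizer-order (ψ S) d' 1 periods d'≡1*d'
    where
    size : ∣ ψ S ∣ ≡ k'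
    size = *-cancelˡ-≡ _ k' e (trans (sym (∣d'-periodic∣ S (M-d'-periodic S∈M))) (trans ∣S∣≡k k≡e*k'))
    periods : ∀ ν → Periodic ν (χ (ψ S)) ⇔ d' ∣ ν
    periods ν = ⇔.trans (periodic-≗ (χ-ψ S∈M)) (M-periods S∈M d≡e*d' ν)

  -- Members of M_e(d, k) are recovered from their characteristic functions, which ψ preserves.
  ψ-injective : ∀ S T → InM e d k S → InM e d k T → ψ S ≡ ψ T → S ≡ T
  ψ-injective S T S∈M T∈M ψS≡ψT =
    χ-injective (λ i → trans (sym (χ-ψ S∈M i)) (trans (cong (λ U → χ U i) ψS≡ψT) (χ-ψ T∈M i)))

  preimage-injective : ∀ {U V} → preimage d'∣d U ≡ preimage d'∣d V → U ≡ V
  preimage-injective {U} {V} eq =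
    χ-injective (λ i → trans (sym (χ-preimage d'∣d U i)) (trans (cong (λ S → χ S i) eq) (χ-preimage d'∣d V i)))

  preimage-ψ : ∀ {S} → InM e d k S → preimage d'∣d (ψ S) ≡ S
  preimage-ψ {S} S∈M = χ-injective (λ i → trans (χ-preimage d'∣d (ψ S) i) (χ-ψ S∈M i))

  preimage-M : ∀ {U} → InM 1 d' k' U → InM e d k (preimage d'∣d U) × ψ (preimage d'∣d U) ≡ U
  preimage-M {U} U∈M@(∣U∣≡k' , _) = (size , stabilizer-order S d' e periods d≡e*d') , ψS≡U
    where
    S = preimage d'∣d U
    periods : ∀ ν → Periodic ν (χ S) ⇔ d' ∣ ν
    periods ν = ⇔.trans (periodic-≗ (χ-preimage d'∣d U)) (M-periods U∈M d'≡1*d' ν)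
    pS : Periodic d' (χ S)
    pS = Equivalence.from (periods d') ∣-refl
    ψS≡U : ψ S ≡ U
    ψS≡U = χ-injective (λ i → trans (χ-reduce d'∣d S pS i) (χ-preimage d'∣d U i))
    size : ∣ S ∣ ≡ k
    size = begin
      ∣ S ∣         ≡⟨ ∣d'-periodic∣ S pS ⟩
      e * ∣ ψ S ∣   ≡⟨ cong (λ V → e * ∣ V ∣) ψS≡U ⟩
      e * ∣ U ∣     ≡⟨ cong (e *_) ∣U∣≡k' ⟩
      e * k'        ≡⟨ k≡e*k' ⟨
      k             ∎
      where open ≡-Reasoning

  ψ-surjective : ∀ U → InM 1 d' k' U → Σ (Subset d) λ S → InM e d k S × ψ S ≡ U
  ψ-surjective U U∈M = preimage d'∣d U , preimage-M U∈M

  -- ψ(ν · S) = (ν mod d') · ψ(S): both sides are d'-periodic and agree after shifting by ν mod d'.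
  ψ-equivariant : ∀ ν S → InM e d k S → ψ (ν · S) ≡ reduce d' ν · ψ S
  ψ-equivariant ν S S∈M = χ-injective (periodic-agree (χ-periodic (ψ T)) (χ-periodic R) (toℕ ν') agreeShifted)
    where
    T = ν · S
    ν' = reduce d' ν
    R = ν' · ψ S
    pT : Periodic d' (χ T)
    pT = periodic-unshift (χ-periodic T) (M-d'-periodic S∈M) (toℕ ν) (χ-translate ν S)
    ν'≡ν : ∀ j → residue {d'} (j + toℕ ν') ≡ residue (j + toℕ ν)
    ν'≡ν j = trans (cong residue (+-comm j _)) (trans (residue-+ (toℕ ν) j) (cong residue (+-comm (toℕ ν) j)))
    agreeShifted : ∀ j → χ (ψ T) (j + toℕ ν') ≡ χ R (j + toℕ ν')
    agreeShifted j = begin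
      χ (ψ T) (j + toℕ ν') ≡⟨ χ-reduce d'∣d T pT _ ⟩
      χ T (j + toℕ ν')     ≡⟨ periodic-residue pT (ν'≡ν j) ⟩
      χ T (j + toℕ ν)      ≡⟨ χ-translate ν S j ⟩
      χ S j                ≡⟨ χ-ψ S∈M j ⟨
      χ (ψ S) j            ≡⟨ χ-translate ν' (ψ S) j ⟨
      χ R (j + toℕ ν')     ∎
      where open ≡-Reasoning

  cardinality : cardM e d k ≡ cardM 1 d' k'
  cardinality = length-filter-bijection (allSubsets d) (allSubsets d') _ _ (preimage d'∣d)
    (allSubsets-unique d) (allSubsets-unique d') (allSubsets-complete d) (allSubsets-complete d')
    preimage-injective (λ U U∈M → proj₁ (preimage-M U∈M)) (λ S S∈M → ψ S , ψ-into S S∈M , preimage-ψ S∈M)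

proposition7 : (d k e d' k' : ℕ) → (nz : NonZero d) → 1 ≤ k → k ≤ d →
    e ∣ gcd d k → (hd : d ≡ e * d') → k ≡ e * k' →
    let instance
          nzd : NonZero d
          nzd = nz
          nzd' : NonZero d'
          nzd' = nonZero-factor {d} {e} {d'} hd nz
        ψ : Subset d → Subset d'
        ψ = image (reduce d')
    in ((S : Subset d) → InM e d k S → InM 1 d' k' (ψ S))
       × ((S T : Subset d) → InM e d k S → InM e d k T → ψ S ≡ ψ T → S ≡ T)
       × ((U : Subset d') → InM 1 d' k' U → Σ (Subset d) λ S → InM e d k S × ψ S ≡ U)
       × ((ν : Fin d) (S : Subset d) → InM e d k S → ψ (ν · S) ≡ reduce d' ν · ψ S)
       × (cardM e d k ≡ cardM 1 d' k')
proposition7 d k e d' k' nz _ _ _ d≡e*d' k≡e*k' =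
  ψ-into , ψ-injective , ψ-surjective , ψ-equivariant , cardinality
  where open Reduction d e d' k k' {{nz}} {{nonZero-factor {d} {e} {d'} d≡e*d' nz}} d≡e*d' k≡e*k'
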